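{- Let $G$ be a graph with no induced $C_4$ and no induced $C_6$, let $u\in V(G)$, and let $X,Y$ be disjoint subsets of $V(G)\setminus\{u\}$ such that: $u$ is adjacent to every vertex of $X$ and to no vertex of $Y$; for every two non-adjacent vertices $x,x'\in X$, the sets $N(x)\cap Y$ and $N(x')\cap Y$ are non-empty and every vertex of $N(x)\cap Y$ is adjacent to every vertex of $N(x')\cap Y$; and there is no induced path $a-b-c-d-e$ with $a,b,c,d\in X$ and $e\in Y$. Then $G[X]$ contains no induced path on $4$ vertices. -}

module Defs where

open import Data.Nat using (ℕ; suc)
open import Data.Fin using (Fin; toℕ)
open import Data.Product using (_×_; Σ; ∃-syntax; _,_)
open import Relation.Nullary using (¬_; Dec)
open import Relation.Binary.PropositionalEquality using (_≡_; _≢_)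
open import Function.Bundles using (_⇔_)
open import Data.Fin using (zero; suc) renaming (_+_ to _+F_)

record Graph (n : ℕ) : Set₁ where
  field
    Adj      : Fin n → Fin n → Set
    sym      : ∀ {x y} → Adj x y → Adj y x
    irrefl   : ∀ {x} → ¬ Adj x x
    adj?     : ∀ x y → Dec (Adj x y)
open Graph public

VSet : ℕ → Set₁
VSet n = Fin n → Set

Distinct : ∀ {n k} → (Fin k → Fin n) → Set
Distinct v = ∀ i j → v i ≡ v j → i ≡ j

PathStep : ∀ {k} → Fin k → Fin k → Set
PathStep i j = (suc (toℕ i) ≡ toℕ j) Data.Sum.⊎ (suc (toℕ j) ≡ toℕ i)
  where import Data.Sum

CycStep : ∀ {k} → Fin k → Fin k → Set
CycStep {k} i j = ((suc (toℕ i)) mod-k≡ (toℕ j)) Data.Sum.⊎ ((suc (toℕ j)) mod-k≡ (toℕ i))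
  where
  import Data.Sum
  _mod-k≡_ : ℕ → ℕ → Set
  a mod-k≡ b = (a ≡ b) Data.Sum.⊎ ((a ≡ k) × (b ≡ 0))

InducedPath : ∀ {n} (G : Graph n) (k : ℕ) → (Fin k → Fin n) → Set
InducedPath G k v = Distinct v × (∀ i j → Adj G (v i) (v j) ⇔ PathStep i j)

InducedCycle : ∀ {n} (G : Graph n) (k : ℕ) → (Fin k → Fin n) → Set
InducedCycle G k v = Distinct v × (∀ i j → Adj G (v i) (v j) ⇔ CycStep i j)

NoInducedC : ∀ {n} → Graph n → ℕ → Set
NoInducedC G k = ∀ v → ¬ InducedCycle G k v

{-# OPTIONS --safe #-}

-- Let a-b-c-d be an induced path in X. As a ≁ d, there are adjacent y, y′ ∈ Y with a ~ y and
-- d ~ y′. Since u sees all of X and none of Y, a Y-vertex adjacent to a cannot see c or d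
-- (that would close an induced C₄ through u); hence y ~ b, or else d-c-b-a-y is a forbidden
-- induced P₅. Symmetrically y′ ~ c and y′ ≁ b, and then y-b-c-y′ is an induced C₄.

module Submission where

open import Defs
open import Data.Nat using (zero; suc; _∸_)
open import Data.Nat.Properties using (suc-injective; <⇒≤; +-∸-assoc; ∸-cancelˡ-≡)
open import Data.Fin using (Fin; zero; suc; toℕ; fromℕ; opposite)
open import Data.Fin.Patterns using (0F; 1F; 2F; 3F; 4F)
open import Data.Fin.Properties
  using (toℕ<n; toℕ-injective; toℕ-fromℕ; opposite-prop; opposite-involutive)
open import Data.Vec.Functional using (Vector; []; _∷_; reverse)
open import Data.Product using (_×_; _,_; proj₁; proj₂; ∃-syntax)
open import Data.Sum using (_⊎_; inj₁; inj₂; swap; map)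
open import Data.Empty using (⊥-elim)
open import Function using (_∘_)
open import Function.Bundles using (_⇔_; mk⇔; Equivalence)
open import Function.Construct.Symmetry using (⇔-sym)
open import Function.Construct.Composition using (_⇔-∘_)
open import Relation.Nullary using (¬_)
open import Relation.Nullary.Decidable using (decidable-stable)
open import Relation.Binary.PropositionalEquality as ≡ using (_≡_; _≢_; ≢-sym; refl; cong)

open Equivalence using (to; from)

PathStep-sym : ∀ {k} {i j : Fin k} → PathStep i j → PathStep j i
PathStep-sym = swap

PathStep-suc : ∀ {k} (i j : Fin k) → PathStep (suc i) (suc j) ⇔ PathStep i j
PathStep-suc i j =
  mk⇔ (map suc-injective suc-injective) (map (cong suc) (cong suc))

¬PathStep-zero-zero : ∀ {k} → ¬ PathStep {suc k} zero zero
¬PathStep-zero-zero (inj₁ ())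
¬PathStep-zero-zero (inj₂ ())

CycStep-sym : ∀ {k} {i j : Fin k} → CycStep i j → CycStep j i
CycStep-sym = swap

CycStep-suc : ∀ {k} (i j : Fin (suc k)) → CycStep {suc (suc k)} (suc i) (suc j) ⇔ PathStep i j
CycStep-suc i j = mk⇔ to′ from′
  where
  to′ : CycStep (suc i) (suc j) → PathStep i j
  to′ (inj₁ (inj₁ e))       = inj₁ (suc-injective e)
  to′ (inj₁ (inj₂ (_ , ())))
  to′ (inj₂ (inj₁ e))       = inj₂ (suc-injective e)
  to′ (inj₂ (inj₂ (_ , ())))
  from′ : PathStep i j → CycStep (suc i) (suc j)
  from′ (inj₁ e) = inj₁ (inj₁ (cong suc e))
  from′ (inj₂ e) = inj₂ (inj₁ (cong suc e))

¬CycStep-zero-zero : ∀ {k} → ¬ CycStep {suc (suc k)} zero zero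
¬CycStep-zero-zero (inj₁ (inj₁ ()))
¬CycStep-zero-zero (inj₁ (inj₂ (() , _)))
¬CycStep-zero-zero (inj₂ (inj₁ ()))
¬CycStep-zero-zero (inj₂ (inj₂ (() , _)))

CycStep-zero-suc : ∀ {k} (j : Fin (suc k)) →
  CycStep {suc (suc k)} zero (suc j) ⇔ (j ≡ zero ⊎ j ≡ fromℕ k)
CycStep-zero-suc {k} j = mk⇔ to′ from′
  where
  to′ : CycStep zero (suc j) → j ≡ zero ⊎ j ≡ fromℕ k
  to′ (inj₁ (inj₁ e))       = inj₁ (toℕ-injective (≡.sym (suc-injective e)))
  to′ (inj₁ (inj₂ (() , _)))
  to′ (inj₂ (inj₁ ()))
  to′ (inj₂ (inj₂ (e , _))) =
    inj₂ (toℕ-injective (≡.trans (suc-injective (suc-injective e)) (≡.sym (toℕ-fromℕ k))))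
  from′ : j ≡ zero ⊎ j ≡ fromℕ k → CycStep zero (suc j)
  from′ (inj₁ refl) = inj₁ (inj₁ refl)
  from′ (inj₂ refl) = inj₂ (inj₂ (cong (λ m → suc (suc m)) (toℕ-fromℕ k) , refl))

opposite-reverses-succ : ∀ {k} (i j : Fin k) →
  suc (toℕ (opposite i)) ≡ toℕ (opposite j) ⇔ suc (toℕ j) ≡ toℕ i
opposite-reverses-succ {k} i j
  rewrite opposite-prop i | opposite-prop j | ≡.sym (+-∸-assoc 1 (toℕ<n i)) =
  mk⇔ (λ e → ≡.sym (∸-cancelˡ-≡ (<⇒≤ (toℕ<n i)) (toℕ<n j) e)) (λ e → cong (k ∸_) (≡.sym e))

PathStep-opposite : ∀ {k} (i j : Fin k) → PathStep (opposite i) (opposite j) ⇔ PathStep i j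
PathStep-opposite i j = mk⇔
  (swap ∘ map (to (opposite-reverses-succ i j)) (to (opposite-reverses-succ j i)))
  (map (from (opposite-reverses-succ i j)) (from (opposite-reverses-succ j i)) ∘ swap)

Induced : ∀ {n k} → Graph n → (Fin k → Fin k → Set) → Vector (Fin n) k → Set
Induced G Step w = Distinct w × (∀ i j → Adj G (w i) (w j) ⇔ Step i j)

module _ {n} (G : Graph n) where

  adj⇒≢ : ∀ {x y} → Adj G x y → x ≢ y
  adj⇒≢ x~y refl = irrefl G x~y

  module _ {k} {Step : Fin k → Fin k → Set} {w : Vector (Fin n) k}
           (w-induced : Induced G Step w) where

    step⇒adj : ∀ {i j} → Step i j → Adj G (w i) (w j)
    step⇒adj = from (proj₂ w-induced _ _)

    ¬step⇒¬adj : ∀ {i j} → ¬ Step i j → ¬ Adj G (w i) (w j)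
    ¬step⇒¬adj ¬step = ¬step ∘ to (proj₂ w-induced _ _)

    ≢⇒distinct : ∀ {i j} → i ≢ j → w i ≢ w j
    ≢⇒distinct i≢j = i≢j ∘ proj₁ w-induced _ _

  Induced-∷ : ∀ {k} {Step : Fin (suc k) → Fin (suc k) → Set} {Step′ : Fin k → Fin k → Set}
    {p : Fin n} {w : Vector (Fin n) k} →
    (∀ {i j} → Step i j → Step j i) → ¬ Step zero zero →
    (∀ i j → Step (suc i) (suc j) ⇔ Step′ i j) →
    Induced G Step′ w → (∀ i → p ≢ w i) → (∀ j → Adj G p (w j) ⇔ Step zero (suc j)) →
    Induced G Step (p ∷ w)
  Induced-∷ {Step = Step} {p = p} {w} step-sym ¬step₀₀ step-suc (w-distinct , w-induced)
    p-fresh p-nbr = p∷w-distinct , p∷w-induced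
    where
    p∷w-distinct : Distinct (p ∷ w)
    p∷w-distinct zero    zero    _ = refl
    p∷w-distinct zero    (suc j) e = ⊥-elim (p-fresh j e)
    p∷w-distinct (suc i) zero    e = ⊥-elim (p-fresh i (≡.sym e))
    p∷w-distinct (suc i) (suc j) e = cong suc (w-distinct i j e)

    p∷w-induced : ∀ i j → Adj G ((p ∷ w) i) ((p ∷ w) j) ⇔ Step i j
    p∷w-induced zero    zero    = mk⇔ (⊥-elim ∘ irrefl G) (⊥-elim ∘ ¬step₀₀)
    p∷w-induced zero    (suc j) = p-nbr j
    p∷w-induced (suc i) zero    =
      mk⇔ (step-sym ∘ to (p-nbr i) ∘ sym G) (sym G ∘ from (p-nbr i) ∘ step-sym)
    p∷w-induced (suc i) (suc j) = ⇔-sym (step-suc i j) ⇔-∘ w-induced i j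

  InducedPath-[_] : ∀ x → InducedPath G 1 (x ∷ [])
  InducedPath-[ x ] = singleton-distinct , singleton-induced
    where
    singleton-distinct : Distinct (x ∷ [])
    singleton-distinct zero zero _ = refl
    singleton-induced : ∀ i j → Adj G ((x ∷ []) i) ((x ∷ []) j) ⇔ PathStep i j
    singleton-induced zero zero = mk⇔ (⊥-elim ∘ irrefl G) (⊥-elim ∘ ¬PathStep-zero-zero {0})

  InducedPath-∷ : ∀ {k p} {w : Vector (Fin n) (suc k)} → InducedPath G (suc k) w →
    Adj G p (w zero) → (∀ i → p ≢ w (suc i)) → (∀ i → ¬ Adj G p (w (suc i))) →
    InducedPath G (suc (suc k)) (p ∷ w)
  InducedPath-∷ {k} {p} {w} w-induced p~w₀ p-fresh p≁ =
    Induced-∷ PathStep-sym (¬PathStep-zero-zero {suc k}) PathStep-suc w-induced fresh nbr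
    where
    fresh : ∀ i → p ≢ w i
    fresh zero    = adj⇒≢ p~w₀
    fresh (suc i) = p-fresh i
    nbr : ∀ j → Adj G p (w j) ⇔ PathStep zero (suc j)
    nbr zero    = mk⇔ (λ _ → inj₁ refl) (λ _ → p~w₀)
    nbr (suc j) = mk⇔ (⊥-elim ∘ p≁ j) λ { (inj₁ ()) ; (inj₂ ()) }

  InducedCycle-∷ : ∀ {k p} {w : Vector (Fin n) (suc k)} → InducedPath G (suc k) w →
    (∀ i → p ≢ w i) → (∀ j → Adj G p (w j) ⇔ (j ≡ zero ⊎ j ≡ fromℕ k)) →
    InducedCycle G (suc (suc k)) (p ∷ w)
  InducedCycle-∷ w-induced p-fresh p-nbr =
    Induced-∷ CycStep-sym ¬CycStep-zero-zero CycStep-suc w-induced p-fresh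
      (λ j → ⇔-sym (CycStep-zero-suc j) ⇔-∘ p-nbr j)

  InducedPath-reverse : ∀ {k} {w : Vector (Fin n) k} →
    InducedPath G k w → InducedPath G k (reverse w)
  InducedPath-reverse (w-distinct , w-induced) =
    (λ i j e → opposite-injective (w-distinct (opposite i) (opposite j) e)) ,
    (λ i j → PathStep-opposite i j ⇔-∘ w-induced (opposite i) (opposite j))
    where
    opposite-injective : ∀ {k} {i j : Fin k} → opposite i ≡ opposite j → i ≡ j
    opposite-injective {i = i} {j} e =
      ≡.trans (≡.sym (opposite-involutive i)) (≡.trans (cong opposite e) (opposite-involutive j))

  square : ∀ {p q r s} → Adj G p q → Adj G q r → Adj G r s → Adj G s p →
    ¬ Adj G p r → ¬ Adj G q s → p ≢ r → q ≢ s → InducedCycle G 4 (p ∷ q ∷ r ∷ s ∷ [])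
  square {p} {q} {r} {s} p~q q~r r~s s~p p≁r q≁s p≢r q≢s =
    InducedCycle-∷ qrs p-fresh p-nbr
    where
    qrs : InducedPath G 3 (q ∷ r ∷ s ∷ [])
    qrs = InducedPath-∷ (InducedPath-∷ InducedPath-[ s ] r~s (λ ()) (λ ()))
                        q~r (λ { 0F → q≢s }) (λ { 0F → q≁s })
    p-fresh : ∀ i → p ≢ (q ∷ r ∷ s ∷ []) i
    p-fresh = λ { 0F → adj⇒≢ p~q ; 1F → p≢r ; 2F → adj⇒≢ (sym G s~p) }
    p-nbr : ∀ j → Adj G p ((q ∷ r ∷ s ∷ []) j) ⇔ (j ≡ zero ⊎ j ≡ fromℕ 2)
    p-nbr = λ { 0F → mk⇔ (λ _ → inj₁ refl) (λ _ → p~q)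
              ; 1F → mk⇔ (⊥-elim ∘ p≁r) λ { (inj₁ ()) ; (inj₂ ()) }
              ; 2F → mk⇔ (λ _ → inj₂ refl) (λ _ → sym G s~p) }

module Setting {n} (G : Graph n) (noC4 : NoInducedC G 4) (u : Fin n) (X Y : VSet n)
  (Y≢u : ∀ y → Y y → y ≢ u) (X∩Y=∅ : ∀ v → X v → ¬ Y v)
  (u~X : ∀ x → X x → Adj G u x) (u≁Y : ∀ y → Y y → ¬ Adj G u y)
  (noP5 : ∀ (v : Vector (Fin n) 5) → InducedPath G 5 v →
    ¬ (X (v 0F) × X (v 1F) × X (v 2F) × X (v 3F) × Y (v 4F)))
  where

  X≢Y : ∀ {x y} → X x → Y y → x ≢ y
  X≢Y Xx Yy refl = X∩Y=∅ _ Xx Yy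

  no-common-Y-neighbour : ∀ {x x′ y} → X x → X x′ → x ≢ x′ → ¬ Adj G x x′ →
    Y y → Adj G x y → ¬ Adj G y x′
  no-common-Y-neighbour Xx Xx′ x≢x′ x≁x′ Yy x~y y~x′ =
    noC4 _ (square G (u~X _ Xx) x~y y~x′ (sym G (u~X _ Xx′))
                     (u≁Y _ Yy) x≁x′ (≢-sym (Y≢u _ Yy)) x≢x′)

  Y-neighbour-of-end : ∀ {v : Vector (Fin n) 4} {y} → InducedPath G 4 v → (∀ i → X (v i)) →
    Y y → Adj G (v 0F) y → Adj G y (v 1F) × ¬ Adj G y (v 2F)
  Y-neighbour-of-end {v} {y} v-induced Xv Yy v₀~y = y~v₁ , y≁ 0F
    where
    y≁ : ∀ i → ¬ Adj G y (v (suc (suc i)))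
    y≁ i = no-common-Y-neighbour (Xv 0F) (Xv (suc (suc i)))
      (≢⇒distinct G v-induced λ ()) (¬step⇒¬adj G v-induced λ { (inj₁ ()) ; (inj₂ ()) }) Yy v₀~y
    y~v₁ : Adj G y (v 1F)
    y~v₁ = decidable-stable (adj? G y (v 1F)) λ y≁v₁ →
      noP5 (reverse (y ∷ v))
        (InducedPath-reverse G (InducedPath-∷ G v-induced (sym G v₀~y)
          (λ i → ≢-sym (X≢Y (Xv (suc i)) Yy))
          λ { 0F → y≁v₁ ; (suc i) → y≁ i }))
        (Xv 3F , Xv 2F , Xv 1F , Xv 0F , Yy)

  ends-have-no-adjacent-Y-neighbours : ∀ {v : Vector (Fin n) 4} {y y′} →
    InducedPath G 4 v → (∀ i → X (v i)) →
    Y y → Adj G (v 0F) y → Y y′ → Adj G (v 3F) y′ → ¬ Adj G y y′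
  ends-have-no-adjacent-Y-neighbours {v} v-induced Xv Yy v₀~y Yy′ v₃~y′ y~y′ =
    let y~v₁ , y≁v₂ = Y-neighbour-of-end v-induced Xv Yy v₀~y
        y′~v₂ , y′≁v₁ =
          Y-neighbour-of-end (InducedPath-reverse G v-induced) (Xv ∘ opposite) Yy′ v₃~y′
    in noC4 _ (square G y~v₁ (step⇒adj G v-induced (inj₁ refl)) (sym G y′~v₂) (sym G y~y′)
                        y≁v₂ (y′≁v₁ ∘ sym G) (≢-sym (X≢Y (Xv 2F) Yy)) (X≢Y (Xv 1F) Yy′))

lemma2p8 : ∀ {n} (G : Graph n) → NoInducedC G 4 → NoInducedC G 6 →
    (u : Fin n) (X Y : VSet n) →
    (∀ x → X x → x ≢ u) → (∀ y → Y y → y ≢ u) → (∀ v → X v → ¬ Y v) →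
    (∀ x → X x → Adj G u x) → (∀ y → Y y → ¬ Adj G u y) →
    (∀ x x′ → X x → X x′ → x ≢ x′ → ¬ Adj G x x′ →
      (∃[ y ] (Y y × Adj G x y)) × (∃[ y ] (Y y × Adj G x′ y)) ×
      (∀ y y′ → Y y → Adj G x y → Y y′ → Adj G x′ y′ → Adj G y y′)) →
    (∀ (v : Fin 5 → Fin n) → InducedPath G 5 v →
      ¬ (X (v zero) × X (v (suc zero)) × X (v (suc (suc zero))) ×
         X (v (suc (suc (suc zero)))) × Y (v (suc (suc (suc (suc zero))))))) →
    ∀ (v : Fin 4 → Fin n) → InducedPath G 4 v →
      ¬ (X (v zero) × X (v (suc zero)) × X (v (suc (suc zero))) × X (v (suc (suc (suc zero)))))
lemma2p8 G noC4 _ u X Y _ Y≢u X∩Y=∅ u~X u≁Y separated noP5 v v-induced (Xa , Xb , Xc , Xd) =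
  let (y , Yy , a~y) , (y′ , Yy′ , d~y′) , Y-complete = separated (v 0F) (v 3F) Xa Xd a≢d a≁d
  in ends-have-no-adjacent-Y-neighbours v-induced Xv Yy a~y Yy′ d~y′
       (Y-complete y y′ Yy a~y Yy′ d~y′)
  where
  open Setting G noC4 u X Y Y≢u X∩Y=∅ u~X u≁Y noP5
  Xv : ∀ i → X (v i)
  Xv = λ { 0F → Xa ; 1F → Xb ; 2F → Xc ; 3F → Xd }
  a≢d : v 0F ≢ v 3F
  a≢d = ≢⇒distinct G v-induced λ ()
  a≁d : ¬ Adj G (v 0F) (v 3F)
  a≁d = ¬step⇒¬adj G v-induced λ { (inj₁ ()) ; (inj₂ ()) }
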